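{- Let $k\ge 3$ be an integer. Up to permutation of colors (i.e., identifying colorings inducing the same partition of the vertex set into color classes), the graph $U(k+1,k)$ has exactly $k+2$ distinct local $k$-colorings: the natural coloring, and for each $x\in[k+1]$ the coloring that agrees with the natural coloring on all vertices $(y,A)$ with $y\neq x$ and assigns to each vertex $(x,A)$ the color equal to the unique element of $[k+1]\setminus(A\cup\{x\})$ (this is the unique way to recolor the class $\{(x,A)\}$ so as to obtain a proper $k$-coloring while keeping all other colors).
   Context: For positive integers $k\le m$, the graph $U(m,k)$ has vertex set $\{(x,A): x\in[m],\ A\subseteq[m],\ |A|=k-1,\ x\notin A\}$, where $[m]=\{1,\dots,m\}$, and vertices $(x,A)$ and $(y,B)$ are adjacent iff $x\in B$ and $y\in A$. The natural coloring of $U(m,k)$ assigns color $x$ to vertex $(x,A)$. A local $k$-coloring of a graph is a proper vertex coloring in which every closed neighborhood $\{v\}\cup N(v)$ receives at most $k$ distinct colors. -}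

module Defs where

open import Data.Nat using (ℕ; _∸_)
open import Data.Fin using (Fin; toℕ; _≟_)
open import Data.Fin.Subset using (Subset; _∈_; _∉_; ∣_∣; outside)
open import Data.Vec using (lookup)
open import Data.Bool using (if_then_else_) renaming (_≟_ to _≟ᵇ_)
open import Data.List using (List; filter; [] ; _∷_)
open import Data.List.Base using (allFin)
open import Data.Product using (Σ; ∃; _×_; _,_)
open import Data.Sum using (_⊎_)
open import Relation.Binary.PropositionalEquality using (_≡_; _≢_)
open import Relation.Nullary using (¬_; ¬?; does)
open import Relation.Nullary.Decidable using (_×-dec_)

record Vertex (m k : ℕ) : Set where
  constructor vtx
  field
    pt    : Fin m
    set   : Subset m
    card  : ∣ set ∣ ≡ k ∸ 1
    notin : pt ∉ set

open Vertex public

Adj : ∀ {m k} → Vertex m k → Vertex m k → Set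
Adj u v = pt u ∈ set v × pt v ∈ set u

Coloring : ℕ → ℕ → Set
Coloring m k = Vertex m k → ℕ

Proper : ∀ {m k} → Coloring m k → Set
Proper {m} {k} c = (u v : Vertex m k) → Adj u v → c u ≢ c v

AtMostColorsNbhd : ∀ {m k} → ℕ → Coloring m k → Vertex m k → Set
AtMostColorsNbhd {m} {k} r c v =
  Σ (Fin r → ℕ) λ f → (w : Vertex m k) → (w ≡ v ⊎ Adj v w) → ∃ λ i → c w ≡ f i

IsLocalColoring : ∀ {m k} → ℕ → Coloring m k → Set
IsLocalColoring {m} {k} r c = Proper c × ((v : Vertex m k) → AtMostColorsNbhd r c v)

_≈c_ : ∀ {m k} → Coloring m k → Coloring m k → Set
_≈c_ {m} {k} c d = (u v : Vertex m k) → (c u ≡ c v → d u ≡ d v) × (d u ≡ d v → c u ≡ c v)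

natural : ∀ {m k} → Coloring m k
natural v = toℕ (pt v)

headOr : ∀ {m} → Fin m → List (Fin m) → Fin m
headOr d []      = d
headOr d (z ∷ _) = z

-- The first element of [m] \ (A ∪ {x}) (default x if there is none);
-- for vertices of U(k+1,k) this is the unique such element.
missing : ∀ {m} → Fin m → Subset m → Fin m
missing {m} x A =
  headOr x (filter (λ z → ¬? (z ≟ x) ×-dec (lookup A z ≟ᵇ outside)) (allFin m))

recolor : ∀ {m k} → Fin m → Coloring m k
recolor x v =
  if does (pt v ≟ x) then toℕ (missing x (set v)) else toℕ (pt v)

module Submission where

-- A vertex (x , A) of U(k+1,k) is determined by x and the unique z ∉ A ∪ {x}, and
-- (x , z) ~ (y , w) iff x ≢ y, y ≢ z and x ≢ w. The k vertices (_ , w) form a clique inside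
-- the closed neighbourhood of every (y , w), so in a local k-coloring they carry all colors
-- seen there; applied to a neighbour (x , z) of (y , w) this gives
-- c (x , z) ∈ {c (x , w) , c (z , w)} for every third point w. Consequently either the row
-- {(x , _)} is monochromatic, or the row of z has the color of (x , z). If all rows are
-- monochromatic, distinct rows get distinct colors and c is the natural coloring. If the
-- row of x₀ is not, every other row z has the color of (x₀ , z), and these colors are
-- distinct, which is recolor x₀.

open import Defs
open import Data.Nat using (ℕ; zero; suc; _+_; _∸_; _≤_; _<_; z≤n; s≤s)
import Data.Nat.Properties as ℕₚ
open import Data.Fin using (Fin; zero; suc; toℕ; punchIn; punchOut; _≟_)
import Data.Fin.Properties as Finₚ
open import Data.Fin.Subset using (Subset; _∈_; _∉_; ∣_∣; inside; outside; ⊤; ∁; _─_; _-_; Nonempty)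
import Data.Fin.Subset.Properties as Subsetₚ
open import Data.Vec using (_∷_; lookup; here; there)
open import Data.Vec.Properties using (lookup⇒[]=; []=⇒lookup)
import Data.Vec.Functional as Vector
open import Data.List using (List; []; _∷_; length; filter; allFin)
open import Data.List.Relation.Unary.All using (All; []; _∷_)
open import Data.List.Relation.Unary.Any using (Any; here; there)
import Data.List.Relation.Unary.Any as Any
open import Data.List.Membership.Propositional.Properties using (∈-allFin)
open import Data.Product using (Σ; ∃; _×_; _,_; proj₁; proj₂)
open import Data.Sum using (_⊎_; inj₁; inj₂)
open import Data.Empty using (⊥; ⊥-elim)
open import Function using (_∘_)
open import Relation.Binary.PropositionalEquality
open import Relation.Nullary using (¬_; yes; no; contradiction)
open import Relation.Nullary.Decidable using (recompute; ¬?)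
open import Relation.Unary using (Pred; Decidable)

∣p∣≤1+∣p-x∣ : ∀ {n} (p : Subset n) (x : Fin n) → ∣ p ∣ ≤ suc ∣ p - x ∣
∣p∣≤1+∣p-x∣ (inside  ∷ p) zero    = ℕₚ.≤-reflexive (cong (suc ∘ ∣_∣) (sym (Subsetₚ.p─⊥≡p p)))
∣p∣≤1+∣p-x∣ (outside ∷ p) zero    = ℕₚ.m≤n⇒m≤1+n (ℕₚ.≤-reflexive (cong ∣_∣ (sym (Subsetₚ.p─⊥≡p p))))
∣p∣≤1+∣p-x∣ (inside  ∷ p) (suc x) = s≤s (∣p∣≤1+∣p-x∣ p x)
∣p∣≤1+∣p-x∣ (outside ∷ p) (suc x) = ∣p∣≤1+∣p-x∣ p x

x∈p⇒1+∣p-x∣≡∣p∣ : ∀ {n} {p : Subset n} {x} → x ∈ p → suc ∣ p - x ∣ ≡ ∣ p ∣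
x∈p⇒1+∣p-x∣≡∣p∣ {p = p} {x} x∈p = ℕₚ.≤-antisym (Subsetₚ.x∈p⇒∣p-x∣<∣p∣ x∈p) (∣p∣≤1+∣p-x∣ p x)

x∈p─q⇒x∉q : ∀ {n} (p q : Subset n) {x} → x ∈ p ─ q → x ∉ q
x∈p─q⇒x∉q (inside ∷ p) (outside ∷ q) here ()
x∈p─q⇒x∉q (_ ∷ p) (_ ∷ q) (there x∈p─q) (there x∈q) = x∈p─q⇒x∉q p q x∈p─q x∈q

x∈p-y⇒x≢y : ∀ {n} {p : Subset n} {x y} → x ∈ p - y → x ≢ y
x∈p-y⇒x≢y {p = p} {y = y} x∈p-y refl = x∈p─q⇒x∉q p _ x∈p-y (Subsetₚ.x∈⁅x⁆ y)

∣p∣>0⇒nonempty : ∀ {n} (p : Subset n) → 0 < ∣ p ∣ → Nonempty p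
∣p∣>0⇒nonempty (inside  ∷ p) _   = zero , here
∣p∣>0⇒nonempty (outside ∷ p) 0<p with y , y∈p ← ∣p∣>0⇒nonempty p 0<p = suc y , there y∈p

∈-avoiding : ∀ {n} (p : Subset n) (xs : List (Fin n)) →
             length xs < ∣ p ∣ → ∃ λ y → y ∈ p × All (y ≢_) xs
∈-avoiding p []       0<p = let y , y∈p = ∣p∣>0⇒nonempty p 0<p in y , y∈p , []
∈-avoiding p (x ∷ xs) xs<p
  with y , y∈p-x , y∉xs ← ∈-avoiding (p - x) xs (ℕₚ.≤-pred (ℕₚ.≤-trans xs<p (∣p∣≤1+∣p-x∣ p x)))
  = y , Subsetₚ.p─q⊆p p _ y∈p-x , x∈p-y⇒x≢y y∈p-x ∷ y∉xs

3≤∣p∣ : ∀ {n} {p : Subset n} {a b c} → a ∈ p → b ∈ p - a → c ∈ p - a - b → 3 ≤ ∣ p ∣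
3≤∣p∣ a∈p b∈p-a c∈p-a-b = removal a∈p (removal b∈p-a (removal c∈p-a-b z≤n))
  where
  removal : ∀ {n m} {p : Subset n} {x} → x ∈ p → m ≤ ∣ p - x ∣ → suc m ≤ ∣ p ∣
  removal x∈p m≤ = ℕₚ.≤-<-trans m≤ (Subsetₚ.x∈p⇒∣p-x∣<∣p∣ x∈p)

lookup≡outside⇔∉ : ∀ {n} (p : Subset n) x → (lookup p x ≡ outside → x ∉ p) × (x ∉ p → lookup p x ≡ outside)
lookup≡outside⇔∉ p x = (λ eq x∈p → inside≢outside (trans (sym ([]=⇒lookup x∈p)) eq)) , ∉⇒outside
  where
  inside≢outside : inside ≢ outside
  inside≢outside ()
  ∉⇒outside : x ∉ p → lookup p x ≡ outside
  ∉⇒outside x∉p with lookup p x in eq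
  ... | outside = refl
  ... | inside  = contradiction (lookup⇒[]= x p eq) x∉p

headOr-filter : ∀ {n ℓ} {P : Pred (Fin n) ℓ} (P? : Decidable P) d xs → Any P xs → P (headOr d (filter P? xs))
headOr-filter P? d (x ∷ xs) Pxs with P? x | Pxs
... | yes Px | _          = Px
... | no ¬Px | here Px    = contradiction Px ¬Px
... | no _   | there Pxs′ = headOr-filter P? d xs Pxs′

missing-spec : ∀ {n} (x : Fin n) (A : Subset n) y → y ≢ x → y ∉ A → missing x A ≢ x × missing x A ∉ A
missing-spec {n} x A y y≢x y∉A = proj₁ spec , proj₁ (lookup≡outside⇔∉ A _) (proj₂ spec)
  where
  spec : missing x A ≢ x × lookup A (missing x A) ≡ outside
  spec = headOr-filter _ x (allFin n) (Any.map (λ { refl → y≢x , proj₂ (lookup≡outside⇔∉ A y) y∉A }) (∈-allFin y))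

distinct-values-exhaust : ∀ {n} {A : Set} (f e : Fin n → A) → (∀ i j → e i ≡ e j → i ≡ j) →
                          (∀ i → ∃ λ a → e i ≡ f a) → ∀ {x} → (∃ λ a → x ≡ f a) → ∃ λ i → x ≡ e i
distinct-values-exhaust {n} f e e-inj e⊆f {x} (a , x≡fa)
  with Finₚ.pigeonhole (ℕₚ.n<1+n n) (a Vector.∷ (proj₁ ∘ e⊆f))
... | zero  , suc i , _   , a≡ = i , trans x≡fa (trans (cong f a≡) (sym (proj₂ (e⊆f i))))
... | suc i , suc i′ , i<i′ , ≡a = contradiction
      (e-inj i i′ (trans (proj₂ (e⊆f i)) (trans (cong f ≡a) (sym (proj₂ (e⊆f i′))))))
      (Finₚ.<⇒≢ (ℕₚ.≤-pred i<i′))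

≈c-via : ∀ {m k} (c d : Coloring m k) (φ : Vertex m k → Fin m) → (∀ u → d u ≡ toℕ (φ u)) →
         (∀ u v → c u ≡ c v → φ u ≡ φ v) → (∀ u v → φ u ≡ φ v → c u ≡ c v) → c ≈c d
≈c-via c d φ d≡φ c⇒φ φ⇒c u v =
    (λ cu≡cv → trans (d≡φ u) (trans (cong toℕ (c⇒φ u v cu≡cv)) (sym (d≡φ v))))
  , (λ du≡dv → φ⇒c u v (Finₚ.toℕ-injective (trans (sym (d≡φ u)) (trans du≡dv (d≡φ v)))))

avoiding⇒AtMostColors : ∀ {r k} (c : Coloring (suc r) k) v (x : Fin (suc r)) →
  (∀ w → w ≡ v ⊎ Adj v w → ∃ λ y → y ≢ x × c w ≡ toℕ y) → AtMostColorsNbhd r c v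
avoiding⇒AtMostColors c v x cols = (toℕ ∘ punchIn x) , λ w w∈N[v] →
  let y , y≢x , cw≡y = cols w w∈N[v]
  in  punchOut (≢-sym y≢x) , trans cw≡y (cong toℕ (sym (Finₚ.punchIn-punchOut (≢-sym y≢x))))

module U (j : ℕ) where

  k : ℕ
  k = 3 + j

  V : Set
  V = Vertex (suc k) k

  -- Kept opaque: a with over fresh (or covered-by-clique below) would otherwise normalise
  -- the subset counting for symbolic j, which exhausts memory.
  opaque
    3<∣⊤∣ : 3 < ∣ ⊤ {suc k} ∣
    3<∣⊤∣ = subst (3 <_) (sym (Subsetₚ.∣⊤∣≡n (suc k))) (s≤s (s≤s (s≤s (s≤s z≤n))))

    fresh : (a b c : Fin (suc k)) → ∃ λ y → y ≢ a × y ≢ b × y ≢ c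
    fresh a b c with y , _ , y≢a ∷ y≢b ∷ y≢c ∷ [] ← ∈-avoiding ⊤ (a ∷ b ∷ c ∷ []) 3<∣⊤∣
      = y , y≢a , y≢b , y≢c

  ∣∁set∣≡2 : (u : V) → ∣ ∁ (set u) ∣ ≡ 2
  ∣∁set∣≡2 u = trans (Subsetₚ.∣∁p∣≡n∸∣p∣ (set u)) (trans (cong (suc k ∸_) (card u)) (ℕₚ.m+n∸n≡m 2 j))

  -- mis u is the point z with ∁ (set u) = {pt u , z}; a vertex (x , A) of U(k+1,k) is the pair (x , z).
  opaque
    mis : V → Fin (suc k)
    mis u = missing (pt u) (set u)

    mis-spec : (u : V) → mis u ≢ pt u × mis u ∉ set u
    mis-spec u
      with y , y∈∁A , y≢x ∷ [] ← ∈-avoiding (∁ (set u)) (pt u ∷ []) (subst (1 <_) (sym (∣∁set∣≡2 u)) ℕₚ.≤-refl)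
      = missing-spec (pt u) (set u) y y≢x (Subsetₚ.x∈∁p⇒x∉p y∈∁A)

  mis≢pt : (u : V) → mis u ≢ pt u
  mis≢pt = proj₁ ∘ mis-spec

  pt≢mis : (u : V) → pt u ≢ mis u
  pt≢mis = ≢-sym ∘ mis≢pt

  ≢pt,mis⇒∈set : (u : V) {y : Fin (suc k)} → y ≢ pt u → y ≢ mis u → y ∈ set u
  ≢pt,mis⇒∈set u {y} y≢x y≢z with y Subsetₚ.∈? set u
  ... | yes y∈A = y∈A
  ... | no  y∉A = ⊥-elim (ℕₚ.<⇒≱ ℕₚ.≤-refl (subst (3 ≤_) (∣∁set∣≡2 u) (3≤∣p∣ x∈∁A z∈∁A-x y∈∁A-x-z)))
    where
    x∈∁A : pt u ∈ ∁ (set u)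
    x∈∁A = Subsetₚ.x∉p⇒x∈∁p (notin u)
    z∈∁A-x : mis u ∈ ∁ (set u) - pt u
    z∈∁A-x = Subsetₚ.x∈p∧x≢y⇒x∈p-y (Subsetₚ.x∉p⇒x∈∁p (proj₂ (mis-spec u))) (mis≢pt u)
    y∈∁A-x-z : y ∈ ∁ (set u) - pt u - mis u
    y∈∁A-x-z = Subsetₚ.x∈p∧x≢y⇒x∈p-y (Subsetₚ.x∈p∧x≢y⇒x∈p-y (Subsetₚ.x∉p⇒x∈∁p y∉A) y≢x) y≢z

  adj⇒≢ : ∀ u v → Adj u v → pt u ≢ pt v × pt v ≢ mis u × pt u ≢ mis v
  adj⇒≢ u v (x∈B , y∈A) = (λ { refl → notin v x∈B })
                            , (λ e → proj₂ (mis-spec u) (subst (_∈ set u) e y∈A))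
                            , (λ e → proj₂ (mis-spec v) (subst (_∈ set v) e x∈B))

  ≢⇒adj : ∀ u v → pt u ≢ pt v → pt v ≢ mis u → pt u ≢ mis v → Adj u v
  ≢⇒adj u v x≢y y≢z x≢w = ≢pt,mis⇒∈set v x≢y x≢w , ≢pt,mis⇒∈set u (≢-sym x≢y) y≢z

  -- The distinctness proof is irrelevant, so vertex x z p depends only on x and z.
  opaque
    pairSet : Fin (suc k) → Fin (suc k) → Subset (suc k)
    pairSet x z = ⊤ - x - z

    ∣pairSet∣ : ∀ x z → .(x ≢ z) → ∣ pairSet x z ∣ ≡ 2 + j
    ∣pairSet∣ x z x≢z = ℕₚ.suc-injective (ℕₚ.suc-injective (begin
      suc (suc ∣ pairSet x z ∣) ≡⟨ cong suc (x∈p⇒1+∣p-x∣≡∣p∣ {p = ⊤ - x} z∈⊤-x) ⟩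
      suc ∣ ⊤ - x ∣             ≡⟨ x∈p⇒1+∣p-x∣≡∣p∣ {p = ⊤} {x} Subsetₚ.∈⊤ ⟩
      ∣ ⊤ {suc k} ∣             ≡⟨ Subsetₚ.∣⊤∣≡n (suc k) ⟩
      suc k                     ∎))
      where
      open ≡-Reasoning
      z∈⊤-x : z ∈ ⊤ - x
      z∈⊤-x = Subsetₚ.x∈p∧x≢y⇒x∈p-y Subsetₚ.∈⊤ (≢-sym (recompute (¬? (x ≟ z)) x≢z))

    x∉pairSet : ∀ x z → x ∉ pairSet x z
    x∉pairSet x z x∈ = x∈p-y⇒x≢y (Subsetₚ.p─q⊆p (⊤ - x) _ x∈) refl

    ∈pairSet : ∀ {x z y} → y ≢ x → y ≢ z → y ∈ pairSet x z
    ∈pairSet y≢x y≢z = Subsetₚ.x∈p∧x≢y⇒x∈p-y (Subsetₚ.x∈p∧x≢y⇒x∈p-y Subsetₚ.∈⊤ y≢x) y≢z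

  vertex : (x z : Fin (suc k)) → .(x ≢ z) → V
  vertex x z x≢z = vtx x (pairSet x z) (∣pairSet∣ x z x≢z) (x∉pairSet x z)

  mis-vertex : ∀ x z .(p : x ≢ z) → mis (vertex x z p) ≡ z
  mis-vertex x z p with mis (vertex x z p) ≟ z
  ... | yes m≡z = m≡z
  ... | no  m≢z = contradiction (∈pairSet (mis≢pt (vertex x z p)) m≢z) (proj₂ (mis-spec (vertex x z p)))

  vertex-cong : ∀ {x x′ z z′} .{p : x ≢ z} .{q : x′ ≢ z′} → x ≡ x′ → z ≡ z′ → vertex x z p ≡ vertex x′ z′ q
  vertex-cong refl refl = refl

  vertex-adj : ∀ {x y z w} .{p : x ≢ z} .{q : y ≢ w} → x ≢ y → y ≢ z → x ≢ w → Adj (vertex x z p) (vertex y w q)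
  vertex-adj {x} {y} {z} {w} {p} {q} x≢y y≢z x≢w =
    ≢⇒adj (vertex x z p) (vertex y w q) x≢y
      (λ e → y≢z (trans e (mis-vertex x z p))) (λ e → x≢w (trans e (mis-vertex y w q)))

  natural-isLocal : IsLocalColoring k natural
  natural-isLocal = (λ u v u~v → proj₁ (adj⇒≢ u v u~v) ∘ Finₚ.toℕ-injective)
                  , λ v → avoiding⇒AtMostColors natural v (mis v) λ w w∈N[v] → pt w , ≢mis w w∈N[v] , refl
    where
    ≢mis : ∀ {v} w → w ≡ v ⊎ Adj v w → pt w ≢ mis v
    ≢mis w (inj₁ refl)     = pt≢mis w
    ≢mis {v} w (inj₂ v~w) = proj₁ (proj₂ (adj⇒≢ v w v~w))

  recolorFin : Fin (suc k) → V → Fin (suc k)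
  recolorFin x v with pt v ≟ x
  ... | yes _ = mis v
  ... | no  _ = pt v

  opaque
    unfolding mis

    recolor≡toℕ∘recolorFin : ∀ x v → recolor x v ≡ toℕ (recolorFin x v)
    recolor≡toℕ∘recolorFin x v with pt v ≟ x
    ... | yes refl = refl
    ... | no  _    = refl

  recolorFin-own : ∀ {x} v → pt v ≡ x → recolorFin x v ≡ mis v
  recolorFin-own v refl with pt v ≟ pt v
  ... | yes _   = refl
  ... | no  x≢x = contradiction refl x≢x

  recolorFin≢ : ∀ x v → recolorFin x v ≢ x
  recolorFin≢ x v with pt v ≟ x
  ... | yes refl = mis≢pt v
  ... | no  y≢x  = y≢x

  recolor≡⇒recolorFin≡ : ∀ x u v → recolor x u ≡ recolor x v → recolorFin x u ≡ recolorFin x v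
  recolor≡⇒recolorFin≡ x u v eq =
    Finₚ.toℕ-injective (trans (sym (recolor≡toℕ∘recolorFin x u)) (trans eq (recolor≡toℕ∘recolorFin x v)))

  recolorFin-adj : ∀ x u v → Adj u v → recolorFin x u ≢ recolorFin x v
  recolorFin-adj x u v u~v with adj⇒≢ u v u~v | pt u ≟ x | pt v ≟ x
  ... | pu≢pv , _ , _ | yes refl | yes pv≡x = contradiction (sym pv≡x) pu≢pv
  ... | _ , pv≢mu , _ | yes _    | no  _    = ≢-sym pv≢mu
  ... | _ , _ , pu≢mv | no  _    | yes _    = pu≢mv
  ... | pu≢pv , _ , _ | no  _    | no  _    = pu≢pv

  recolor-isLocal : ∀ x → IsLocalColoring k (recolor x)
  recolor-isLocal x =
      (λ u v u~v → recolorFin-adj x u v u~v ∘ recolor≡⇒recolorFin≡ x u v)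
    , λ v → avoiding⇒AtMostColors (recolor x) v x λ w _ → recolorFin x w , recolorFin≢ x w , recolor≡toℕ∘recolorFin x w

  twin : Fin (suc k) → Fin k → V
  twin x i = vertex x (punchIn x i) (≢-sym (Finₚ.punchInᵢ≢i x i))

  recolor-splits-twins : ∀ x → recolor x (twin x zero) ≢ recolor x (twin x (suc zero))
  recolor-splits-twins x eq with Finₚ.punchIn-injective x zero (suc zero) (begin
    punchIn x zero                       ≡⟨ mis-vertex x _ _ ⟨
    mis (twin x zero)                    ≡⟨ recolorFin-own (twin x zero) refl ⟨
    recolorFin x (twin x zero)           ≡⟨ recolor≡⇒recolorFin≡ x (twin x zero) (twin x (suc zero)) eq ⟩
    recolorFin x (twin x (suc zero))     ≡⟨ recolorFin-own (twin x (suc zero)) refl ⟩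
    mis (twin x (suc zero))              ≡⟨ mis-vertex x _ _ ⟩
    punchIn x (suc zero)                 ∎)
    where open ≡-Reasoning
  ... | ()

  recolor-joins-twins : ∀ x y → x ≢ y → recolor y (twin x zero) ≡ recolor y (twin x (suc zero))
  recolor-joins-twins x y x≢y with x ≟ y
  ... | yes x≡y = contradiction x≡y x≢y
  ... | no  _   = refl

  natural≉recolor : ∀ x → ¬ (natural ≈c recolor x)
  natural≉recolor x natural≈recolor =
    recolor-splits-twins x (proj₁ (natural≈recolor (twin x zero) (twin x (suc zero))) refl)

  recolor-injective : ∀ x y → recolor x ≈c recolor y → x ≡ y
  recolor-injective x y recolor≈ with x ≟ y
  ... | yes x≡y = x≡y
  ... | no  x≢y = contradiction (proj₂ (recolor≈ (twin x zero) (twin x (suc zero))) (recolor-joins-twins x y x≢y))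
                                (recolor-splits-twins x)

  module Classification (c : Coloring (suc k) k) (proper : Proper c)
                        (local : ∀ v → AtMostColorsNbhd k c v) where

    vertex-colors-differ : ∀ {x y z w} .{p : x ≢ z} .{q : y ≢ w} →
                           x ≢ y → y ≢ z → x ≢ w → c (vertex x z p) ≢ c (vertex y w q)
    vertex-colors-differ {x} {y} {z} {w} {p} {q} x≢y y≢z x≢w =
      proper (vertex x z p) (vertex y w q) (vertex-adj {p = p} {q} x≢y y≢z x≢w)

    clique : Fin (suc k) → Fin k → V
    clique w i = vertex (punchIn w i) w (Finₚ.punchInᵢ≢i w i)

    -- The clique of the k vertices with second point w lies in the closed neighbourhood
    -- of (y , w); being rainbow, it already shows all k colors available there.
    nbhd-colors-in-clique : ∀ {y w} (y≢w : y ≢ w) v → v ≡ vertex y w y≢w ⊎ Adj (vertex y w y≢w) v →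
                            ∃ λ i → c v ≡ c (clique w i)
    nbhd-colors-in-clique {y} {w} y≢w v v∈N =
      distinct-values-exhaust (proj₁ (local t)) (c ∘ clique w) rainbow clique⊆N (proj₂ (local t) v v∈N)
      where
      t : V
      t = vertex y w y≢w
      rainbow : ∀ i i′ → c (clique w i) ≡ c (clique w i′) → i ≡ i′
      rainbow i i′ eq with i ≟ i′
      ... | yes i≡i′ = i≡i′
      ... | no  i≢i′ = contradiction eq (vertex-colors-differ (i≢i′ ∘ Finₚ.punchIn-injective w i i′)
                         (Finₚ.punchInᵢ≢i w i′) (Finₚ.punchInᵢ≢i w i))
      clique⊆N : ∀ i → ∃ λ a → c (clique w i) ≡ proj₁ (local t) a
      clique⊆N i with punchIn w i ≟ y
      ... | yes refl = proj₂ (local t) (clique w i) (inj₁ refl)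
      ... | no  a≢y  = proj₂ (local t) (clique w i)
                         (inj₂ (vertex-adj {p = y≢w} {Finₚ.punchInᵢ≢i w i} (≢-sym a≢y) (Finₚ.punchInᵢ≢i w i) y≢w))

    opaque
      covered-by-clique : ∀ u w → w ≢ pt u → ∃ λ a → Σ (a ≢ w) λ a≢w → c u ≡ c (vertex a w a≢w)
      covered-by-clique u w w≢x with y , y≢x , y≢z , y≢w ← fresh (pt u) (mis u) w
        with i , cu≡ ← nbhd-colors-in-clique y≢w u
                         (inj₂ (≢⇒adj (vertex y w y≢w) u y≢x (λ e → w≢x (sym (trans e (mis-vertex y w y≢w)))) y≢z))
        = punchIn w i , Finₚ.punchInᵢ≢i w i , cu≡

    -- A vertex is not determined by (pt , mis) up to ≡ (notin is a function), but its color is.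
    c≡c-vertex : ∀ u → c u ≡ c (vertex (pt u) (mis u) (pt≢mis u))
    c≡c-vertex u with covered-by-clique u (mis u) (mis≢pt u)
    ... | a , a≢z , cu≡ with a ≟ pt u
    ...   | yes refl = cu≡
    ...   | no  a≢x  = contradiction cu≡ (proper u (vertex a (mis u) a≢z)
                       (≢⇒adj u (vertex a (mis u) a≢z) (≢-sym a≢x) a≢z
                         (λ e → pt≢mis u (trans e (mis-vertex a (mis u) a≢z)))))

    two-choices : ∀ {x z w} (x≢z : x ≢ z) (w≢x : w ≢ x) (w≢z : w ≢ z) →
                    c (vertex x w (≢-sym w≢x)) ≡ c (vertex x z x≢z)
                  ⊎ c (vertex z w (≢-sym w≢z)) ≡ c (vertex x z x≢z)
    two-choices {x} {z} {w} x≢z w≢x w≢z with covered-by-clique (vertex x z x≢z) w w≢x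
    ... | a , _ , c≡ with a ≟ x | a ≟ z
    ...   | yes refl | _        = inj₁ (sym c≡)
    ...   | no  _    | yes refl = inj₂ (sym c≡)
    ...   | no  a≢x  | no  a≢z  = contradiction c≡ (vertex-colors-differ (≢-sym a≢x) a≢z (≢-sym w≢x))

    no-monochromatic-triangle : ∀ {x z w} (x≢z : x ≢ z) (z≢w : z ≢ w) (w≢x : w ≢ x) →
      c (vertex x z x≢z) ≡ c (vertex z w z≢w) → c (vertex z w z≢w) ≢ c (vertex w x w≢x)
    no-monochromatic-triangle {x} {z} {w} x≢z z≢w w≢x xz≡zw zw≡wx with v , v≢x , v≢z , v≢w ← fresh x z w
      with two-choices x≢z v≢x v≢z
    ... | inj₁ xv≡xz = vertex-colors-differ x≢z (≢-sym v≢z) (≢-sym w≢x) (trans xv≡xz xz≡zw)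
    ... | inj₂ zv≡xz = vertex-colors-differ z≢w (≢-sym v≢w) (≢-sym x≢z) (trans zv≡xz (trans xz≡zw zw≡wx))

    row-monochromatic : ∀ {x z w} (x≢z : x ≢ z) (w≢x : w ≢ x) → w ≢ z →
      c (vertex x w (≢-sym w≢x)) ≡ c (vertex x z x≢z) →
      ∀ z′ (x≢z′ : x ≢ z′) → c (vertex x z′ x≢z′) ≡ c (vertex x z x≢z)
    row-monochromatic {x} {z} {w} x≢z w≢x w≢z xw≡xz z′ x≢z′ with z′ ≟ z
    ... | yes refl = refl
    ... | no  z′≢z with two-choices x≢z (≢-sym x≢z′) z′≢z
    ...   | inj₁ xz′≡xz = xz′≡xz
    ...   | inj₂ zz′≡xz = contradiction (trans zz′≡xz (sym xw≡xz)) (vertex-colors-differ (≢-sym x≢z) x≢z′ (≢-sym w≢z))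

    next-row-monochromatic : ∀ {x z w} (x≢z : x ≢ z) (w≢x : w ≢ x) (w≢z : w ≢ z) →
      c (vertex z w (≢-sym w≢z)) ≡ c (vertex x z x≢z) →
      ∀ w′ (w′≢z : w′ ≢ z) → c (vertex z w′ (≢-sym w′≢z)) ≡ c (vertex x z x≢z)
    next-row-monochromatic {x} {z} {w} x≢z w≢x w≢z zw≡xz w′ w′≢z with w′ ≟ x
    ... | yes refl with two-choices (≢-sym w≢z) x≢z (≢-sym w≢x)
    ...   | inj₁ zx≡zw = trans zx≡zw zw≡xz
    ...   | inj₂ wx≡zw = contradiction (sym wx≡zw) (no-monochromatic-triangle x≢z (≢-sym w≢z) w≢x (sym zw≡xz))
    next-row-monochromatic {x} {z} {w} x≢z w≢x w≢z zw≡xz w′ w′≢z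
        | no w′≢x with two-choices x≢z w′≢x w′≢z
    ...   | inj₁ xw′≡xz = contradiction (trans xw′≡xz (sym zw≡xz)) (vertex-colors-differ x≢z (≢-sym w′≢z) (≢-sym w≢x))
    ...   | inj₂ zw′≡xz = zw′≡xz

    -- By row-monochromatic, TwinsAgree x holds iff all vertices (x , _) share one color;
    -- unlike the latter, it is decidable.
    TwinsAgree : Fin (suc k) → Set
    TwinsAgree x = c (twin x zero) ≡ c (twin x (suc zero))

    module _ (agree : ∀ x → TwinsAgree x) where

      row-constant : ∀ x z (x≢z : x ≢ z) → c (vertex x z x≢z) ≡ c (twin x zero)
      row-constant x = row-monochromatic (≢-sym (Finₚ.punchInᵢ≢i x zero)) (Finₚ.punchInᵢ≢i x (suc zero))
        (Finₚ.0≢1+n ∘ sym ∘ Finₚ.punchIn-injective x (suc zero) zero) (sym (agree x))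

      ≈natural : c ≈c natural
      ≈natural = ≈c-via c natural pt (λ _ → refl) same-color⇒same-pt same-pt⇒same-color
        where
        c≡row : ∀ u → c u ≡ c (twin (pt u) zero)
        c≡row u = trans (c≡c-vertex u) (row-constant (pt u) (mis u) (pt≢mis u))
        same-pt⇒same-color : ∀ u v → pt u ≡ pt v → c u ≡ c v
        same-pt⇒same-color u v x≡y = trans (c≡row u) (trans (cong (λ x → c (twin x zero)) x≡y) (sym (c≡row v)))
        same-color⇒same-pt : ∀ u v → c u ≡ c v → pt u ≡ pt v
        same-color⇒same-pt u v cu≡cv with pt u ≟ pt v
        ... | yes x≡y = x≡y
        ... | no  x≢y with a , a≢x , a≢y , _ ← fresh (pt u) (pt v) (pt v) =
          contradiction (begin
            c (vertex (pt u) a (≢-sym a≢x)) ≡⟨ row-constant (pt u) a (≢-sym a≢x) ⟩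
            c (twin (pt u) zero)            ≡⟨ c≡row u ⟨
            c u                             ≡⟨ cu≡cv ⟩
            c v                             ≡⟨ c≡row v ⟩
            c (twin (pt v) zero)            ≡⟨ row-constant (pt v) a (≢-sym a≢y) ⟨
            c (vertex (pt v) a (≢-sym a≢y)) ∎)
          (vertex-colors-differ x≢y (≢-sym a≢y) (≢-sym a≢x))
          where open ≡-Reasoning

    module _ (x₀ : Fin (suc k)) (split : ¬ TwinsAgree x₀) where

      -- The first option of two-choices would make the row of x₀ monochromatic.
      other-row-constant : ∀ z (z≢x₀ : z ≢ x₀) w (w≢z : w ≢ z) →
                           c (vertex z w (≢-sym w≢z)) ≡ c (vertex x₀ z (≢-sym z≢x₀))
      other-row-constant z z≢x₀ with w , w≢x₀ , w≢z , _ ← fresh x₀ z z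
        with two-choices (≢-sym z≢x₀) w≢x₀ w≢z
      ... | inj₂ zw≡x₀z = next-row-monochromatic (≢-sym z≢x₀) w≢x₀ w≢z zw≡x₀z
      ... | inj₁ x₀w≡x₀z = contradiction (trans (x₀-row zero) (sym (x₀-row (suc zero)))) split
        where
        x₀-row : ∀ i → c (twin x₀ i) ≡ c (vertex x₀ z (≢-sym z≢x₀))
        x₀-row i = row-monochromatic (≢-sym z≢x₀) w≢x₀ w≢z x₀w≡x₀z (punchIn x₀ i) (≢-sym (Finₚ.punchInᵢ≢i x₀ i))

      c≡recolor-vertex : ∀ u → c u ≡ c (vertex x₀ (recolorFin x₀ u) (≢-sym (recolorFin≢ x₀ u)))
      c≡recolor-vertex u with pt u ≟ x₀
      ... | yes refl = c≡c-vertex u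
      ... | no  x≢x₀ = trans (c≡c-vertex u) (other-row-constant (pt u) x≢x₀ (mis u) (mis≢pt u))

      ≈recolor : c ≈c recolor x₀
      ≈recolor = ≈c-via c (recolor x₀) (recolorFin x₀) (recolor≡toℕ∘recolorFin x₀)
                   same-color⇒same-R same-R⇒same-color
        where
        same-R⇒same-color : ∀ u v → recolorFin x₀ u ≡ recolorFin x₀ v → c u ≡ c v
        same-R⇒same-color u v eq =
          trans (c≡recolor-vertex u) (trans (cong c (vertex-cong refl eq)) (sym (c≡recolor-vertex v)))
        swap : ∀ a (a≢x₀ : a ≢ x₀) → c (vertex a x₀ a≢x₀) ≡ c (vertex x₀ a (≢-sym a≢x₀))
        swap a a≢x₀ = other-row-constant a a≢x₀ x₀ (≢-sym a≢x₀)
        same-color⇒same-R : ∀ u v → c u ≡ c v → recolorFin x₀ u ≡ recolorFin x₀ v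
        same-color⇒same-R u v cu≡cv with recolorFin x₀ u ≟ recolorFin x₀ v
        ... | yes eq = eq
        ... | no  a≢b = contradiction (begin
            c (vertex a x₀ a≢x₀)            ≡⟨ swap a a≢x₀ ⟩
            c (vertex x₀ a (≢-sym a≢x₀))    ≡⟨ c≡recolor-vertex u ⟨
            c u                             ≡⟨ cu≡cv ⟩
            c v                             ≡⟨ c≡recolor-vertex v ⟩
            c (vertex x₀ b (≢-sym b≢x₀))    ≡⟨ swap b b≢x₀ ⟨
            c (vertex b x₀ b≢x₀)            ∎)
          (vertex-colors-differ a≢b b≢x₀ a≢x₀)
          where
          open ≡-Reasoning
          a b : Fin (suc k)
          a = recolorFin x₀ u
          b = recolorFin x₀ v
          a≢x₀ : a ≢ x₀
          a≢x₀ = recolorFin≢ x₀ u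
          b≢x₀ : b ≢ x₀
          b≢x₀ = recolorFin≢ x₀ v

    twins-agree? : Decidable TwinsAgree
    twins-agree? x = c (twin x zero) ℕₚ.≟ c (twin x (suc zero))

    classification : c ≈c natural ⊎ ∃ λ x → c ≈c recolor x
    classification with Finₚ.all? twins-agree?
    ... | yes agree  = inj₁ (≈natural agree)
    ... | no  ¬agree with x , split ← Finₚ.¬∀⟶∃¬ (suc k) TwinsAgree twins-agree? ¬agree
      = inj₂ (x , ≈recolor x split)

lemma4 : (k : ℕ) → 3 ≤ k →
    IsLocalColoring {suc k} {k} k natural
    × ((x : Fin (suc k)) → IsLocalColoring {suc k} {k} k (recolor x))
    × ((x : Fin (suc k)) → ¬ (_≈c_ {suc k} {k} natural (recolor x)))
    × ((x y : Fin (suc k)) → _≈c_ {suc k} {k} (recolor x) (recolor y) → x ≡ y)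
    × ((c : Coloring (suc k) k) → IsLocalColoring k c →
    _≈c_ c natural ⊎ ∃ λ x → _≈c_ c (recolor x))
lemma4 (suc (suc (suc j))) (s≤s (s≤s (s≤s z≤n))) =
    natural-isLocal
  , recolor-isLocal
  , natural≉recolor
  , recolor-injective
  , λ c (proper , local) → Classification.classification c proper local
  where open U j
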